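{- Let $t \ge 2$ be an integer. In the game \textsc{MiMark}-$t$ (\textsc{Mark}-$t$ in misère play), the set of P-positions is exactly $$D'_t = (D_t \setminus \{t^{2k+1} : k \ge 0\}) \cup \{t^{2k} : k \ge 0\},$$ and the set of N-positions is exactly $$V'_t = (V_t \setminus \{t^{2k} : k \ge 0\}) \cup \{t^{2k+1} : k \ge 0\}.$$
   Context: \textsc{Mark}-$t$ is the impartial game whose positions are the nonnegative integers; from a position $n \ge 1$ a move goes to any nonnegative one of $n-1, \ldots, n-(t-1)$, or to $\lfloor n/t \rfloor$; $0$ has no moves. In misère play the player unable to move wins. A P-position is one from which the previous player (the one who just moved) has a winning strategy; an N-position is one from which the next player to move has a winning strategy. $D_t$ (the dopey numbers in base $t$) is the set of positive integers whose base-$t$ representation ends with an odd number of consecutive trailing zeros; $V_t$ (the vile numbers in base $t$) is the set of nonnegative integers not in $D_t$, i.e. those whose base-$t$ representation ends with an even number (possibly zero) of trailing zeros, with $0 \in V_t$. -}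

module Defs where

open import Data.Nat using (ℕ; zero; suc; _+_; _*_; _∸_; _^_; _≤_; _<_; NonZero)
open import Data.Nat.DivMod using (_/_)
open import Data.Nat.Divisibility using (_∣_)
open import Data.Product using (Σ; ∃; _×_)
open import Data.Sum using (_⊎_)
open import Relation.Nullary using (¬_)
open import Relation.Binary.PropositionalEquality using (_≡_)

data Move (t : ℕ) .{{_ : NonZero t}} : ℕ → ℕ → Set where
  sub : ∀ {n} i → 1 ≤ i → i ≤ t ∸ 1 → i ≤ n → Move t n (n ∸ i)
  div : ∀ {n} → 1 ≤ n → Move t n (n / t)

-- N n : the next player wins (in misère play a terminal position is an N-position,
--         since the player unable to move wins; otherwise some move leads to a P-position)
--   P n : the previous player wins (the position has a move and every move leads to
--         an N-position)
data MisereP (t : ℕ) .{{_ : NonZero t}} : ℕ → Set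
data MisereN (t : ℕ) .{{_ : NonZero t}} : ℕ → Set

data MisereP t where
  allN : ∀ {n} → (∃ λ m → Move t n m) → (∀ m → Move t n m → MisereN t m) → MisereP t n

data MisereN t where
  terminal : ∀ {n} → (∀ m → ¬ Move t n m) → MisereN t n
  toP      : ∀ {n} m → Move t n m → MisereP t m → MisereN t n

-- Dopey numbers: positive n whose base-t representation ends with an odd number
-- of trailing zeros, i.e. n = t^(2k+1) * m with t ∤ m.
Dopey : ℕ → ℕ → Set
Dopey t n = 1 ≤ n × (∃ λ k → ∃ λ m → (n ≡ t ^ (2 * k + 1) * m) × ¬ (t ∣ m))

Vile : ℕ → ℕ → Set
Vile t n = ¬ Dopey t n

OddPow : ℕ → ℕ → Set
OddPow t n = ∃ λ k → n ≡ t ^ (2 * k + 1)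

EvenPow : ℕ → ℕ → Set
EvenPow t n = ∃ λ k → n ≡ t ^ (2 * k)

Dopey' : ℕ → ℕ → Set
Dopey' t n = (Dopey t n × ¬ OddPow t n) ⊎ EvenPow t n

Vile' : ℕ → ℕ → Set
Vile' t n = (Vile t n × ¬ EvenPow t n) ⊎ OddPow t n

-- Write n = t^a m with t ∤ m. Dopey numbers are those with a odd, and multiplying by t
-- flips the parity of a, so q ∈ V'_t exactly when t q ∈ D'_t (for q ≥ 1); apart from 1,
-- every non-multiple of t lies in V'_t. Induction on n: a multiple t q is a P-position
-- exactly when q is an N-position, since then q ≥ 2 and the remaining moves from t q
-- reach non-multiples of t above 1. A non-multiple n ≥ t moves both to q = n / t and,
-- by subtracting n mod t, to t q; these lie on opposite sides, so one is a P-position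
-- (a non-multiple n < t moves to 1 instead).
module Submission where

open import Defs
open import Data.Nat
  using (ℕ; zero; suc; _+_; _*_; _∸_; _^_; _≤_; _<_; _<?_; z≤n; s≤s; NonZero; _/_)
open import Data.Nat.Properties
open import Data.Nat.DivMod using (m≡m%n+[m/n]*n; m%n≡m∸m/n*n; m%n<n; m*n/n≡m; m<n⇒m/n≡0; m≥n⇒m/n>0)
open import Data.Nat.Divisibility
  using (_∣_; divides; _∣?_; ∣-trans; m∣m*n; n∣m*n; ∣1⇒≡1; ∣m+n∣m⇒∣n; ∣⇒≤; m%n≡0⇒n∣m)
open import Data.Nat.Induction using (<-rec)
open import Data.Product using (∃; _×_; _,_)
open import Data.Sum using (_⊎_; inj₁; inj₂)
open import Function using (_∘_)
open import Function.Bundles using (_⇔_; mk⇔)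
open import Relation.Nullary using (¬_; yes; no; contradiction)
open import Relation.Binary.PropositionalEquality using (_≡_; refl; sym; trans; cong; subst; module ≡-Reasoning)

Odd : ℕ → Set
Odd a = ∃ λ k → a ≡ 2 * k + 1

2k+1≡1+2k : ∀ k → 2 * k + 1 ≡ suc (2 * k)
2k+1≡1+2k k = +-comm (2 * k) 1

2*[1+k]≡1+[2k+1] : ∀ k → 2 * suc k ≡ suc (2 * k + 1)
2*[1+k]≡1+[2k+1] k = trans (*-suc 2 k) (cong suc (sym (2k+1≡1+2k k)))

even-or-odd : ∀ a → (∃ λ k → a ≡ 2 * k) ⊎ Odd a
even-or-odd zero = inj₁ (0 , refl)
even-or-odd (suc a) with even-or-odd a
... | inj₁ (k , refl) = inj₂ (k , sym (2k+1≡1+2k k))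
... | inj₂ (k , refl) = inj₁ (suc k , sym (2*[1+k]≡1+[2k+1] k))

¬odd-0 : ¬ Odd 0
¬odd-0 (k , 0≡2k+1) = 0≢1+n (trans 0≡2k+1 (2k+1≡1+2k k))

¬odd⇒odd-suc : ∀ {a} → ¬ Odd a → Odd (suc a)
¬odd⇒odd-suc {a} ¬odd with even-or-odd a
... | inj₁ (k , refl) = k , sym (2k+1≡1+2k k)
... | inj₂ odd = contradiction odd ¬odd

odd-suc⇒¬odd : ∀ {a} → Odd (suc a) → ¬ Odd a
odd-suc⇒¬odd (k , 1+a≡2k+1) (j , refl) =
  even≢odd (suc j) k (trans (2*[1+k]≡1+[2k+1] j) (trans 1+a≡2k+1 (2k+1≡1+2k k)))

P⇒¬N : ∀ {t} .{{_ : NonZero t}} {n} → MisereP t n → ¬ MisereN t n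
P⇒¬N (allN (m , n→m) _)  (terminal no-move) = no-move m n→m
P⇒¬N (allN _ all-N)      (toP m n→m p)      = P⇒¬N p (all-N m n→m)

N-0 : ∀ {t} .{{_ : NonZero t}} → MisereN t 0
N-0 = terminal λ { _ (sub i 1≤i _ i≤0) → contradiction (≤-trans 1≤i i≤0) λ () ; _ (div ()) }

sub-move : ∀ {t} .{{_ : NonZero t}} {m n} → m < n → n ∸ m < t → Move t n m
sub-move {m = m} {n} m<n n∸m<t =
  subst (Move _ n) (m∸[m∸n]≡n (<⇒≤ m<n)) (sub (n ∸ m) (m<n⇒0<n∸m m<n) (<⇒≤pred n∸m<t) (m∸n≤m n m))

module MiMark (t : ℕ) .{{_ : NonZero t}} (1<t : 1 < t) where

  t∤1 : ¬ t ∣ 1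
  t∤1 t∣1 = <⇒≢ 1<t (sym (∣1⇒≡1 t∣1))

  m<m*t : ∀ {m} → 1 ≤ m → m < m * t
  m<m*t {suc m} _ = m<m*n (suc m) t 1<t

  infix 4 _HasValuation_
  data _HasValuation_ (n a : ℕ) : Set where
    valuation : ∀ m → n ≡ t ^ a * m → ¬ t ∣ m → n HasValuation a

  valuation-0 : ∀ {n} → ¬ t ∣ n → n HasValuation 0
  valuation-0 {n} t∤n = valuation n (sym (*-identityˡ n)) t∤n

  valuation-^ : ∀ a → t ^ a HasValuation a
  valuation-^ a = valuation 1 (sym (*-identityʳ (t ^ a))) t∤1

  valuation-t* : ∀ {q a} → q HasValuation a → t * q HasValuation suc a
  valuation-t* {a = a} (valuation m q≡ t∤m) =
    valuation m (trans (cong (t *_) q≡) (sym (*-assoc t (t ^ a) m))) t∤m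

  valuation-0⇒¬valuation-suc : ∀ {n b} → n HasValuation 0 → ¬ n HasValuation suc b
  valuation-0⇒¬valuation-suc {b = b} (valuation m n≡m t∤m) (valuation m′ n≡ _) =
    t∤m (subst (t ∣_) (trans (sym n≡) (trans n≡m (*-identityˡ m)))
                      (∣-trans (m∣m*n (t ^ b)) (m∣m*n m′)))

  valuation-unique : ∀ {n a b} → n HasValuation a → n HasValuation b → a ≡ b
  valuation-unique {a = zero}  {zero}  _  _  = refl
  valuation-unique {a = zero}  {suc b} va vb = contradiction vb (valuation-0⇒¬valuation-suc va)
  valuation-unique {a = suc a} {zero}  va vb = contradiction va (valuation-0⇒¬valuation-suc vb)
  valuation-unique {n} {suc a} {suc b} (valuation m n≡ t∤m) (valuation m′ n≡′ t∤m′) =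
    cong suc (valuation-unique (valuation m refl t∤m) (valuation m′ t^a*m≡t^b*m′ t∤m′))
    where
    t^a*m≡t^b*m′ : t ^ a * m ≡ t ^ b * m′
    t^a*m≡t^b*m′ = *-cancelˡ-≡ _ _ t (begin
      t * (t ^ a * m)   ≡⟨ *-assoc t (t ^ a) m ⟨
      t ^ suc a * m     ≡⟨ n≡ ⟨
      n                 ≡⟨ n≡′ ⟩
      t ^ suc b * m′    ≡⟨ *-assoc t (t ^ b) m′ ⟩
      t * (t ^ b * m′)  ∎)
      where open ≡-Reasoning

  valuation-exists : ∀ n → 1 ≤ n → ∃ (n HasValuation_)
  valuation-exists = <-rec (λ n → 1 ≤ n → ∃ (n HasValuation_)) step
    where
    step : ∀ n → (∀ {m} → m < n → 1 ≤ m → ∃ (m HasValuation_)) → 1 ≤ n → ∃ (n HasValuation_)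
    step n ih 1≤n with t ∣? n
    ... | no t∤n = 0 , valuation-0 t∤n
    ... | yes (divides zero refl) = contradiction 1≤n λ ()
    ... | yes (divides q@(suc _) refl) with ih (m<m*t {q} (s≤s z≤n)) (s≤s z≤n)
    ...   | a , v = suc a , subst (_HasValuation suc a) (*-comm t q) (valuation-t* v)

  dopey⇒odd-valuation : ∀ {n a} → Dopey t n → n HasValuation a → Odd a
  dopey⇒odd-valuation (_ , k , m , n≡ , t∤m) va = k , valuation-unique va (valuation m n≡ t∤m)

  odd-valuation⇒dopey : ∀ {n a} → 1 ≤ n → n HasValuation a → Odd a → Dopey t n
  odd-valuation⇒dopey 1≤n (valuation m n≡ t∤m) (k , refl) = 1≤n , k , m , n≡ , t∤m

  ¬dopey-indivisible : ∀ {n} → ¬ t ∣ n → ¬ Dopey t n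
  ¬dopey-indivisible t∤n d = ¬odd-0 (dopey⇒odd-valuation d (valuation-0 t∤n))

  dopey-t*⇒¬dopey : ∀ {q} → Dopey t (t * q) → ¬ Dopey t q
  dopey-t*⇒¬dopey d (_ , k , m , q≡ , t∤m) =
    odd-suc⇒¬odd (dopey⇒odd-valuation d (valuation-t* (valuation m q≡ t∤m))) (k , refl)

  ¬dopey⇒dopey-t* : ∀ {q} → 1 ≤ q → ¬ Dopey t q → Dopey t (t * q)
  ¬dopey⇒dopey-t* {q} 1≤q ¬d with valuation-exists q 1≤q
  ... | a , v = odd-valuation⇒dopey (≤-trans 1≤q (m≤n*m q t)) (valuation-t* v)
                  (¬odd⇒odd-suc (¬d ∘ odd-valuation⇒dopey 1≤q v))

  evenPow-indivisible : ∀ {n} → ¬ t ∣ n → EvenPow t n → n ≡ 1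
  evenPow-indivisible t∤n (zero , n≡1) = n≡1
  evenPow-indivisible t∤n (suc k , refl) =
    contradiction (valuation-unique (valuation-0 t∤n) (valuation-^ (2 * suc k))) λ ()

  oddPow-evenPow-disjoint : ∀ {n} → OddPow t n → ¬ EvenPow t n
  oddPow-evenPow-disjoint (j , refl) (k , t^[2j+1]≡t^2k) =
    even≢odd k j (trans (valuation-unique v2k (valuation-^ (2 * j + 1))) (2k+1≡1+2k j))
    where
    v2k : t ^ (2 * j + 1) HasValuation (2 * k)
    v2k = subst (_HasValuation (2 * k)) (sym t^[2j+1]≡t^2k) (valuation-^ (2 * k))

  t^[2k+1]≡t*t^2k : ∀ k → t ^ (2 * k + 1) ≡ t * t ^ (2 * k)
  t^[2k+1]≡t*t^2k k = cong (t ^_) (2k+1≡1+2k k)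

  t^2[1+k]≡t*t^[2k+1] : ∀ k → t ^ (2 * suc k) ≡ t * t ^ (2 * k + 1)
  t^2[1+k]≡t*t^[2k+1] k = cong (t ^_) (2*[1+k]≡1+[2k+1] k)

  oddPow-t*⇒evenPow : ∀ {q} → OddPow t (t * q) → EvenPow t q
  oddPow-t*⇒evenPow (k , tq≡) = k , *-cancelˡ-≡ _ _ t (trans tq≡ (t^[2k+1]≡t*t^2k k))

  evenPow⇒oddPow-t* : ∀ {q} → EvenPow t q → OddPow t (t * q)
  evenPow⇒oddPow-t* (k , refl) = k , sym (t^[2k+1]≡t*t^2k k)

  evenPow-t*⇒oddPow : ∀ {q} → EvenPow t (t * q) → OddPow t q
  evenPow-t*⇒oddPow {q} (zero , tq≡1) = contradiction (subst (t ∣_) tq≡1 (m∣m*n q)) t∤1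
  evenPow-t*⇒oddPow (suc k , tq≡) = k , *-cancelˡ-≡ _ _ t (trans tq≡ (t^2[1+k]≡t*t^[2k+1] k))

  oddPow⇒evenPow-t* : ∀ {q} → OddPow t q → EvenPow t (t * q)
  oddPow⇒evenPow-t* (k , refl) = suc k , sym (t^2[1+k]≡t*t^[2k+1] k)

  dopey'-1 : Dopey' t 1
  dopey'-1 = inj₂ (0 , refl)

  vile'-0 : Vile' t 0
  vile'-0 = inj₁ ((λ { (() , _) }) , λ { (k , 0≡t^2k) → <⇒≢ (m^n>0 t (2 * k)) 0≡t^2k })

  dopey'-vile'-disjoint : ∀ {n} → Dopey' t n → ¬ Vile' t n
  dopey'-vile'-disjoint (inj₁ (d , _))  (inj₁ (¬d , _)) = ¬d d
  dopey'-vile'-disjoint (inj₁ (_ , ¬o)) (inj₂ o)        = ¬o o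
  dopey'-vile'-disjoint (inj₂ e)        (inj₁ (_ , ¬e)) = ¬e e
  dopey'-vile'-disjoint (inj₂ e)        (inj₂ o)        = oddPow-evenPow-disjoint o e

  vile'-indivisible : ∀ {n} → 1 < n → ¬ t ∣ n → Vile' t n
  vile'-indivisible 1<n t∤n =
    inj₁ (¬dopey-indivisible t∤n , λ e → <⇒≢ 1<n (sym (evenPow-indivisible t∤n e)))

  vile'⇒2≤ : ∀ {q} → 1 ≤ q → Vile' t q → 2 ≤ q
  vile'⇒2≤ {suc zero}    _ v = contradiction v (dopey'-vile'-disjoint dopey'-1)
  vile'⇒2≤ {suc (suc _)} _ _ = s≤s (s≤s z≤n)

  dopey'-*t : ∀ {q} → 1 ≤ q → Vile' t q → Dopey' t (q * t)
  dopey'-*t {q} 1≤q v = subst (Dopey' t) (*-comm t q) (dopey'-t* v)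
    where
    dopey'-t* : Vile' t q → Dopey' t (t * q)
    dopey'-t* (inj₁ (¬d , ¬e)) = inj₁ (¬dopey⇒dopey-t* 1≤q ¬d , ¬e ∘ oddPow-t*⇒evenPow)
    dopey'-t* (inj₂ o)         = inj₂ (oddPow⇒evenPow-t* o)

  vile'-*t : ∀ {q} → Dopey' t q → Vile' t (q * t)
  vile'-*t {q} d = subst (Vile' t) (*-comm t q) (vile'-t* d)
    where
    vile'-t* : Dopey' t q → Vile' t (t * q)
    vile'-t* (inj₁ (d , ¬o)) = inj₁ ((λ d′ → dopey-t*⇒¬dopey d′ d) , ¬o ∘ evenPow-t*⇒oddPow)
    vile'-t* (inj₂ e)        = inj₂ (evenPow⇒oddPow-t* e)

  move-from-1 : ∀ {m} → Move t 1 m → m ≡ 0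
  move-from-1 (sub _ 1≤i _ _) = m≤n⇒m∸n≡0 1≤i
  move-from-1 (div _)         = m<n⇒m/n≡0 1<t

  P-1 : MisereP t 1
  P-1 = allN (0 , sub 1 ≤-refl (<⇒≤pred 1<t) ≤-refl)
             λ m 1→m → subst (MisereN t) (sym (move-from-1 1→m)) N-0

  div-*t : ∀ {q} → 1 ≤ q → Move t (q * t) q
  div-*t {q} 1≤q = subst (Move t (q * t)) (m*n/n≡m q t) (div (≤-trans 1≤q (<⇒≤ (m<m*t 1≤q))))

  [n/t]*t<n : ∀ {n} → ¬ t ∣ n → n / t * t < n
  [n/t]*t<n {n} t∤n = subst (n / t * t <_) (sym (m≡m%n+[m/n]*n n t))
                            (m<n+m (n / t * t) (n≢0⇒n>0 (t∤n ∘ m%n≡0⇒n∣m n t)))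

  n∸[n/t]*t<t : ∀ n → n ∸ n / t * t < t
  n∸[n/t]*t<t n = subst (_< t) (m%n≡m∸m/n*n n t) (m%n<n n t)

  t∤*t∸ : ∀ {q i} → 1 ≤ i → i < t → i ≤ q * t → ¬ t ∣ q * t ∸ i
  t∤*t∸ {q} {i@(suc _)} _ i<t i≤q*t t∣q*t∸i = <⇒≱ i<t (∣⇒≤ t∣i)
    where
    t∣i : t ∣ i
    t∣i = ∣m+n∣m⇒∣n (subst (t ∣_) (sym (m∸n+n≡m i≤q*t)) (n∣m*n q)) t∣q*t∸i

  1<*t∸ : ∀ {q i} → 2 ≤ q → i < t → 1 < q * t ∸ i
  1<*t∸ {suc zero} (s≤s ()) _
  1<*t∸ {suc q′@(suc _)} {i} _ i<t = begin-strict
    1                  <⟨ 1<t ⟩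
    t                  ≤⟨ m≤n*m t q′ ⟩
    q′ * t             ≤⟨ m≤n+m (q′ * t) (t ∸ i) ⟩
    t ∸ i + q′ * t     ≡⟨ +-∸-comm (q′ * t) (<⇒≤ i<t) ⟨
    suc q′ * t ∸ i     ∎
    where open ≤-Reasoning

  Classified : ℕ → Set
  Classified n = (Dopey' t n × MisereP t n) ⊎ (Vile' t n × MisereN t n)

  ClassifiedBelow : ℕ → Set
  ClassifiedBelow n = ∀ {m} → m < n → Classified m

  classified-P : ∀ {n} → Classified n → Dopey' t n → MisereP t n
  classified-P (inj₁ (_ , p)) _ = p
  classified-P (inj₂ (v , _)) d = contradiction v (dopey'-vile'-disjoint d)

  classified-N : ∀ {n} → Classified n → Vile' t n → MisereN t n
  classified-N (inj₂ (_ , x)) _ = x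
  classified-N (inj₁ (d , _)) v = contradiction v (dopey'-vile'-disjoint d)

  classified⇒⇔ : ∀ {n} → Classified n → (MisereP t n ⇔ Dopey' t n) × (MisereN t n ⇔ Vile' t n)
  classified⇒⇔ c = mk⇔ (P⇒dopey' c) (classified-P c) , mk⇔ (N⇒vile' c) (classified-N c)
    where
    P⇒dopey' : ∀ {n} → Classified n → MisereP t n → Dopey' t n
    P⇒dopey' (inj₁ (d , _)) _ = d
    P⇒dopey' (inj₂ (_ , x)) p = contradiction x (P⇒¬N p)
    N⇒vile' : ∀ {n} → Classified n → MisereN t n → Vile' t n
    N⇒vile' (inj₂ (v , _)) _ = v
    N⇒vile' (inj₁ (_ , p)) x = contradiction x (P⇒¬N p)

  classified-*t : ∀ {q} → 1 ≤ q → ClassifiedBelow (q * t) → Classified (q * t)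
  classified-*t {q} 1≤q ih with ih (m<m*t 1≤q)
  ... | inj₁ (d , p) = inj₂ (vile'-*t d , toP q (div-*t 1≤q) p)
  ... | inj₂ (v , x) = inj₁ (dopey'-*t 1≤q v , allN (q , div-*t 1≤q) all-N)
    where
    all-N : ∀ m → Move t (q * t) m → MisereN t m
    all-N _ (div _) = subst (MisereN t) (sym (m*n/n≡m q t)) x
    all-N _ (sub i 1≤i i≤pred[t] i≤q*t) =
      classified-N (ih (∸-monoʳ-< 1≤i i≤q*t))
                   (vile'-indivisible (1<*t∸ {q} {i} (vile'⇒2≤ 1≤q v) i<t) (t∤*t∸ {q} 1≤i i<t i≤q*t))
      where
      i<t : i < t
      i<t = m≤pred[n]⇒suc[m]≤n i≤pred[t]

  N-via-quotient : ∀ {n} → 1 ≤ n / t → n / t * t < n → ClassifiedBelow n → MisereN t n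
  N-via-quotient {n} 1≤q q*t<n ih with ih (≤-<-trans (m≤m*n (n / t) t) q*t<n)
  ... | inj₁ (_ , p) = toP (n / t) (div (≤-<-trans z≤n q*t<n)) p
  ... | inj₂ (v , _) = toP (n / t * t) (sub-move q*t<n (n∸[n/t]*t<t n))
                           (classified-P (ih q*t<n) (dopey'-*t 1≤q v))

  N-indivisible : ∀ {n} → 1 < n → ¬ t ∣ n → ClassifiedBelow n → MisereN t n
  N-indivisible {n} 1<n t∤n ih with n <? t
  ... | yes n<t = toP 1 (sub-move 1<n (≤-<-trans (m∸n≤m n 1) n<t)) P-1
  ... | no n≮t  = N-via-quotient (m≥n⇒m/n>0 (≮⇒≥ n≮t)) ([n/t]*t<n t∤n) ih

  classified : ∀ n → Classified n
  classified = <-rec Classified step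
    where
    step : ∀ n → ClassifiedBelow n → Classified n
    step zero          _  = inj₂ (vile'-0 , N-0)
    step (suc zero)    _  = inj₁ (dopey'-1 , P-1)
    step n@(suc (suc _)) ih with t ∣? n
    ... | no t∤n = inj₂ (vile'-indivisible 1<n t∤n , N-indivisible 1<n t∤n ih)
      where
      1<n : 1 < n
      1<n = s≤s (s≤s z≤n)
    ... | yes (divides q@(suc _) n≡q*t) =
      subst Classified (sym n≡q*t) (classified-*t {q} (s≤s z≤n) (subst ClassifiedBelow n≡q*t ih))

theorem5 : (t : ℕ) .{{_ : NonZero t}} → 2 ≤ t →
    ∀ n → (MisereP t n ⇔ Dopey' t n) × (MisereN t n ⇔ Vile' t n)
theorem5 t 2≤t n = classified⇒⇔ (classified n)
  where open MiMark t 2≤t
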